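{- Let $a,b\in Ag$ with $a\neq b$. There exist formulas $\varphi,\psi\in\mathrm{Fm}_{\mathsf S}$ such that $\not\vdash_{\mathsf S}S_{a,b}\varphi\land K_a(\varphi\to\psi)\land K_b\psi\to K_b\varphi$.
   Context: Let $Ag$ be a non-empty finite set of agents (with at least two elements) and $Var$ a countably infinite set of propositional variables. The formulas $\mathrm{Fm}_{\mathsf S}$ are generated by $\varphi::=p\mid\neg\varphi\mid\varphi\land\varphi\mid I_a\varphi\mid K_a\varphi\mid B_a\varphi$ ($p\in Var$, $a\in Ag$), with $\lor,\to$ classical abbreviations. The logic $\mathsf S$ ($\vdash_{\mathsf S}\varphi$ means $\varphi$ is derivable) has as axioms: all classical tautologies; for each $a$ and $\star\in\{K_a,B_a,I_a\}$, $\star(\varphi\to\psi)\to(\star\varphi\to\star\psi)$; $K_a\varphi\to\varphi$; $K_a\varphi\to K_aK_a\varphi$; $B_a\varphi\to\neg B_a\neg\varphi$; $K_a\varphi\to B_a\varphi$; $B_a\varphi\to K_aB_a\varphi$; $I_a\varphi\to\neg I_a\neg\varphi$; $I_a\varphi\to K_aI_a\varphi$; $I_a\varphi\to I_aK_a\varphi$; $I_a\varphi\to I_aI_a\varphi$; rules: modus ponens and necessitation for each $K_a,B_a,I_a$. $S_{a,b}\varphi:=K_a\varphi\land B_a\neg K_b\varphi\land I_a(\varphi\land\neg K_b\varphi)$. -}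

module Defs where

open import Data.Nat using (ℕ)
open import Data.Fin using (Fin)
open import Data.Bool using (Bool; true; false; not; _∧_)
open import Relation.Binary.PropositionalEquality using (_≡_)

-- Agents: Fin n (a finite set; "at least two agents" follows from a ≢ b).
-- Propositional variables: ℕ (countably infinite).
module Syntax (n : ℕ) where

  infixr 6 _∧'_
  infixr 5 _⇒_

  data Fm : Set where
    var  : ℕ → Fm
    ¬'_  : Fm → Fm
    _∧'_ : Fm → Fm → Fm
    I    : Fin n → Fm → Fm
    K    : Fin n → Fm → Fm
    B    : Fin n → Fm → Fm

  _∨'_ : Fm → Fm → Fm
  φ ∨' ψ = ¬' ((¬' φ) ∧' (¬' ψ))

  _⇒_ : Fm → Fm → Fm
  φ ⇒ ψ = ¬' (φ ∧' (¬' ψ))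

  -- Classical tautologies: formulas true under every Boolean valuation that
  -- treats variables and modal formulas (I_a φ, K_a φ, B_a φ) as atoms.
  ⟦_⟧ : Fm → (Fm → Bool) → Bool
  ⟦ var p ⟧   v = v (var p)
  ⟦ ¬' φ ⟧    v = not (⟦ φ ⟧ v)
  ⟦ φ ∧' ψ ⟧  v = ⟦ φ ⟧ v ∧ ⟦ ψ ⟧ v
  ⟦ I a φ ⟧   v = v (I a φ)
  ⟦ K a φ ⟧   v = v (K a φ)
  ⟦ B a φ ⟧   v = v (B a φ)

  Tautology : Fm → Set
  Tautology φ = (v : Fm → Bool) → ⟦ φ ⟧ v ≡ true

  infix 2 ⊢_
  data ⊢_ : Fm → Set where
    taut  : ∀ {φ} → Tautology φ → ⊢ φ
    distK : ∀ {a φ ψ} → ⊢ K a (φ ⇒ ψ) ⇒ (K a φ ⇒ K a ψ)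
    distB : ∀ {a φ ψ} → ⊢ B a (φ ⇒ ψ) ⇒ (B a φ ⇒ B a ψ)
    distI : ∀ {a φ ψ} → ⊢ I a (φ ⇒ ψ) ⇒ (I a φ ⇒ I a ψ)
    axT   : ∀ {a φ} → ⊢ K a φ ⇒ φ
    ax4   : ∀ {a φ} → ⊢ K a φ ⇒ K a (K a φ)
    axDB  : ∀ {a φ} → ⊢ B a φ ⇒ ¬' B a (¬' φ)
    axKB  : ∀ {a φ} → ⊢ K a φ ⇒ B a φ
    axBKB : ∀ {a φ} → ⊢ B a φ ⇒ K a (B a φ)
    axDI  : ∀ {a φ} → ⊢ I a φ ⇒ ¬' I a (¬' φ)
    axIKI : ∀ {a φ} → ⊢ I a φ ⇒ K a (I a φ)
    axIIK : ∀ {a φ} → ⊢ I a φ ⇒ I a (K a φ)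
    axIII : ∀ {a φ} → ⊢ I a φ ⇒ I a (I a φ)
    mp    : ∀ {φ ψ} → ⊢ φ ⇒ ψ → ⊢ φ → ⊢ ψ
    necK  : ∀ {a φ} → ⊢ φ → ⊢ K a φ
    necB  : ∀ {a φ} → ⊢ φ → ⊢ B a φ
    necI  : ∀ {a φ} → ⊢ φ → ⊢ I a φ

  S : Fin n → Fin n → Fm → Fm
  S a b φ = K a φ ∧' (B a (¬' K b φ) ∧' I a (φ ∧' ¬' K b φ))

{-# OPTIONS --safe #-}
-- S is sound for finite Kripke models in which each agent reads K, B and I through
-- one reflexive transitive relation; finiteness makes satisfaction decidable, so each
-- world is a Boolean valuation and the tautologies are valid. Take two worlds, let p
-- hold only in the actual one, let b confuse the two worlds and let every other agent
-- see only its own world. At the actual world a knows p and both believes and intends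
-- that b does not know p; a knows p → (p → p) and b knows p → p, yet b does not know p.
module Submission where

open import Defs
open import Data.Nat using (ℕ)
open import Data.Fin using (Fin; zero; suc; _≟_)
open import Data.Fin.Properties using (all?)
open import Data.Bool using (Bool; true; false; T; not; _∧_)
open import Data.Product using (Σ; _×_; _,_)
open import Data.Sum using (_⊎_; inj₁; inj₂)
open import Function using (id)
open import Level using (0ℓ)
open import Relation.Binary.Core using (Rel)
open import Relation.Binary.Definitions using (Decidable; Reflexive; Transitive)
open import Relation.Binary.PropositionalEquality using (_≡_; _≢_; refl; sym; trans; cong; cong₂; subst)
open import Relation.Nullary using (¬_; Dec; does; proof; contradiction)
open import Relation.Nullary.Decidable using (T?; ¬?; _×-dec_; _→-dec_; _⊎-dec_; decidable-stable)
open import Relation.Nullary.Reflects using (Reflects; invert)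

does-true : {A : Set} (a? : Dec A) → does a? ≡ true → A
does-true a? eq = invert (subst (Reflects _) eq (proof a?))

⇒-intro : {A B : Set} → (A → B) → ¬ (A × ¬ B)
⇒-intro f (a , ¬b) = ¬b (f a)

⇒-elim : {A B : Set} → Dec B → ¬ (A × ¬ B) → A → B
⇒-elim b? a⇒b a = decidable-stable b? λ ¬b → a⇒b (a , ¬b)

module Kripke (n : ℕ) where
  open Syntax n

  record S4Model (m : ℕ) : Set₁ where
    field
      R       : Fin n → Rel (Fin m) 0ℓ
      R?      : ∀ c → Decidable (R c)
      R-refl  : ∀ c → Reflexive (R c)
      R-trans : ∀ c → Transitive (R c)
      V       : ℕ → Fin m → Bool

  module Satisfaction {m : ℕ} (M : S4Model m) where
    open S4Model M

    infix 3 _⊨_ _⊨?_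

    mutual
      _⊨_ : Fin m → Fm → Set
      w ⊨ var p  = T (V p w)
      w ⊨ ¬' φ   = ¬ (w ⊨ φ)
      w ⊨ φ ∧' ψ = (w ⊨ φ) × (w ⊨ ψ)
      w ⊨ I c φ  = □ c φ w
      w ⊨ K c φ  = □ c φ w
      w ⊨ B c φ  = □ c φ w

      □ : Fin n → Fm → Fin m → Set
      □ c φ w = ∀ v → R c w v → v ⊨ φ

    _⊨?_ : ∀ w φ → Dec (w ⊨ φ)
    w ⊨? var p  = T? (V p w)
    w ⊨? ¬' φ   = ¬? (w ⊨? φ)
    w ⊨? φ ∧' ψ = (w ⊨? φ) ×-dec (w ⊨? ψ)
    w ⊨? I c φ  = all? λ v → R? c w v →-dec v ⊨? φ
    w ⊨? K c φ  = all? λ v → R? c w v →-dec v ⊨? φ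
    w ⊨? B c φ  = all? λ v → R? c w v →-dec v ⊨? φ

    valuationAt : Fin m → Fm → Bool
    valuationAt w χ = does (w ⊨? χ)

    ⟦⟧-valuationAt : ∀ w φ → ⟦ φ ⟧ (valuationAt w) ≡ does (w ⊨? φ)
    ⟦⟧-valuationAt w (var p)  = refl
    ⟦⟧-valuationAt w (¬' φ)   = cong not (⟦⟧-valuationAt w φ)
    ⟦⟧-valuationAt w (φ ∧' ψ) = cong₂ _∧_ (⟦⟧-valuationAt w φ) (⟦⟧-valuationAt w ψ)
    ⟦⟧-valuationAt w (I c φ)  = refl
    ⟦⟧-valuationAt w (K c φ)  = refl
    ⟦⟧-valuationAt w (B c φ)  = refl

    tautology-valid : ∀ {φ} → Tautology φ → ∀ w → w ⊨ φ
    tautology-valid {φ} t w =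
      does-true (w ⊨? φ) (trans (sym (⟦⟧-valuationAt w φ)) (t (valuationAt w)))

    □-distrib : ∀ c φ ψ {w} → □ c (φ ⇒ ψ) w → □ c φ w → □ c ψ w
    □-distrib c φ ψ □φ⇒ψ □φ v r = ⇒-elim (v ⊨? ψ) (□φ⇒ψ v r) (□φ v r)

    □-reflexive : ∀ c φ {w} → □ c φ w → w ⊨ φ
    □-reflexive c φ □φ = □φ _ (R-refl c)

    □-transitive : ∀ c φ {w} → □ c φ w → ∀ v → R c w v → □ c φ v
    □-transitive c φ □φ v r u r′ = □φ u (R-trans c r r′)

    □-serial : ∀ c φ {w} → □ c φ w → ¬ □ c (¬' φ) w
    □-serial c φ □φ □¬φ = □¬φ _ (R-refl c) (□-reflexive c φ □φ)

    sound : ∀ {φ} → ⊢ φ → ∀ w → w ⊨ φ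
    sound (taut {φ} t)              = tautology-valid {φ} t
    sound (distK {c} {φ} {ψ}) w     = ⇒-intro λ □φ⇒ψ → ⇒-intro (□-distrib c φ ψ □φ⇒ψ)
    sound (distB {c} {φ} {ψ}) w     = ⇒-intro λ □φ⇒ψ → ⇒-intro (□-distrib c φ ψ □φ⇒ψ)
    sound (distI {c} {φ} {ψ}) w     = ⇒-intro λ □φ⇒ψ → ⇒-intro (□-distrib c φ ψ □φ⇒ψ)
    sound (axT {c} {φ}) w           = ⇒-intro (□-reflexive c φ)
    sound (ax4 {c} {φ}) w           = ⇒-intro (□-transitive c φ)
    sound (axDB {c} {φ}) w          = ⇒-intro (□-serial c φ)
    sound axKB w                    = ⇒-intro λ □φ → □φ
    sound (axBKB {c} {φ}) w         = ⇒-intro (□-transitive c φ)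
    sound (axDI {c} {φ}) w          = ⇒-intro (□-serial c φ)
    sound (axIKI {c} {φ}) w         = ⇒-intro (□-transitive c φ)
    sound (axIIK {c} {φ}) w         = ⇒-intro (□-transitive c φ)
    sound (axIII {c} {φ}) w         = ⇒-intro (□-transitive c φ)
    sound (mp {ψ = ψ} d e) w        = ⇒-elim (w ⊨? ψ) (sound d w) (sound e w)
    sound (necK d) w                = λ v _ → sound d v
    sound (necB d) w                = λ v _ → sound d v
    sound (necI d) w                = λ v _ → sound d v

module Countermodel {n : ℕ} {a b : Fin n} (a≢b : a ≢ b) where
  open Syntax n
  open Kripke n

  indistinguishableFor : Fin n → Rel (Fin 2) 0ℓ
  indistinguishableFor c u v = c ≡ b ⊎ u ≡ v

  indistinguishableFor-trans : ∀ c → Transitive (indistinguishableFor c)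
  indistinguishableFor-trans c (inj₁ c≡b) _          = inj₁ c≡b
  indistinguishableFor-trans c (inj₂ _)   (inj₁ c≡b) = inj₁ c≡b
  indistinguishableFor-trans c (inj₂ u≡v) (inj₂ v≡w) = inj₂ (trans u≡v v≡w)

  actual : Fin 2
  actual = zero

  isActual : Fin 2 → Bool
  isActual zero    = true
  isActual (suc _) = false

  model : S4Model 2
  model = record
    { R       = indistinguishableFor
    ; R?      = λ c u v → (c ≟ b) ⊎-dec (u ≟ v)
    ; R-refl  = λ c → inj₂ refl
    ; R-trans = indistinguishableFor-trans
    ; V       = λ _ → isActual
    }

  open Satisfaction model public

  p : Fm
  p = var 0

  a-sees-only-its-world : ∀ {u v} → indistinguishableFor a u v → u ≡ v
  a-sees-only-its-world (inj₁ a≡b) = contradiction a≡b a≢b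
  a-sees-only-its-world (inj₂ u≡v) = u≡v

  b-does-not-know-p : ∀ w → ¬ (w ⊨ K b p)
  b-does-not-know-p w Kbp = Kbp (suc zero) (inj₁ refl)

  a-knows-p : actual ⊨ K a p
  a-knows-p v r = subst (_⊨ p) (a-sees-only-its-world r) _

  a-sincerely-informs-b-of-p : actual ⊨ S a b p
  a-sincerely-informs-b-of-p =
    a-knows-p , (λ v _ → b-does-not-know-p v) , λ v r → a-knows-p v r , b-does-not-know-p v

  a-knows-p⇒[p⇒p] : actual ⊨ K a (p ⇒ (p ⇒ p))
  a-knows-p⇒[p⇒p] _ _ = ⇒-intro λ _ → ⇒-intro id

  b-knows-p⇒p : actual ⊨ K b (p ⇒ p)
  b-knows-p⇒p _ _ = ⇒-intro id

proposition11 : (n : ℕ) → let open Syntax n in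
    (a b : Fin n) → a ≢ b →
    Σ Fm λ φ → Σ Fm λ ψ →
      ¬ (⊢ (S a b φ ∧' K a (φ ⇒ ψ)) ∧' K b ψ ⇒ K b φ)
proposition11 n a b a≢b = p , p ⇒ p , λ ⊢χ →
  b-does-not-know-p actual
    (⇒-elim (actual ⊨? K b p) (sound ⊢χ actual)
      ((a-sincerely-informs-b-of-p , a-knows-p⇒[p⇒p]) , b-knows-p⇒p))
  where
    open Syntax n
    open Countermodel a≢b
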